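{- If $\mathbf{V}$ is a variety of finite monoids, then $\mathbf{M}_e\mathbf{V}$ is a variety of finite monoids.
   Context: A variety of finite monoids is a class of finite monoids closed under finite direct products, submonoids and quotients (homomorphic images). For a finite monoid $M$, write $s_1\le_{\mathcal J}s_2$ if $s_1=rs_2t$ for some $r,t\in M$. For an idempotent $e\in M$ ($e^2=e$), $M_e$ denotes the submonoid of $M$ generated by $\{m\in M: e\le_{\mathcal J} m\}$. $\mathbf{M}_e\mathbf{V}$ is the class of finite monoids $M$ such that for every idempotent $e\in M$, the monoid $eM_ee$ (with identity $e$) belongs to $\mathbf{V}$. -}

module Defs where

open import Level using (0ℓ)
open import Data.Nat using (ℕ; _*_)
open import Data.Fin using (Fin)
open import Data.Fin.Properties using (*↔×; 1↔⊤)
open import Data.Unit using (⊤; tt)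
open import Data.Product using (Σ; ∃; ∃-syntax; _×_; _,_; proj₁; proj₂)
open import Data.Product.Function.NonDependent.Propositional using (_×-↔_)
open import Function.Bundles using (_↔_)
open import Function.Properties.Inverse using (↔-sym; ↔-trans)
open import Function.Definitions using (Injective; Surjective)
open import Relation.Binary.PropositionalEquality using (_≡_; refl; cong₂)
open import Algebra.Structures using (IsMonoid)
open import Algebra.Definitions using (Associative)

record FinMonoid : Set₁ where
  field
    Carrier  : Set
    _∙_      : Carrier → Carrier → Carrier
    ε        : Carrier
    isMonoid : IsMonoid _≡_ _∙_ ε
    size     : ℕ
    finite   : Carrier ↔ Fin size
  open IsMonoid isMonoid public
  infixl 7 _∙_

open FinMonoid public using (Carrier)

record IsHom (M N : FinMonoid) (f : Carrier M → Carrier N) : Set where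
  private
    module M = FinMonoid M
    module N = FinMonoid N
  field
    preserves-∙ : ∀ x y → f (x M.∙ y) ≡ f x N.∙ f y
    preserves-ε : f M.ε ≡ N.ε

trivial : FinMonoid
trivial = record
  { Carrier = ⊤ ; _∙_ = λ _ _ → tt ; ε = tt
  ; isMonoid = record
      { isSemigroup = record
          { isMagma = record
              { isEquivalence = record { refl = refl ; sym = λ { refl → refl } ; trans = λ { refl q → q } }
              ; ∙-cong = λ _ _ → refl }
          ; assoc = λ _ _ _ → refl }
      ; identity = (λ _ → refl) , (λ _ → refl) }
  ; size = 1 ; finite = ↔-sym 1↔⊤ }

_⊗_ : FinMonoid → FinMonoid → FinMonoid
A ⊗ B = record
  { Carrier = Carrier A × Carrier B
  ; _∙_ = λ { (a , b) (a′ , b′) → (a A.∙ a′) , (b B.∙ b′) }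
  ; ε = A.ε , B.ε
  ; isMonoid = record
      { isSemigroup = record
          { isMagma = record
              { isEquivalence = record { refl = refl ; sym = λ { refl → refl } ; trans = λ { refl q → q } }
              ; ∙-cong = λ { refl refl → refl } }
          ; assoc = λ { (a , b) (a′ , b′) (a″ , b″) → cong₂ _,_ (A.assoc a a′ a″) (B.assoc b b′ b″) } }
      ; identity = (λ { (a , b) → cong₂ _,_ (A.identityˡ a) (B.identityˡ b) })
                 , (λ { (a , b) → cong₂ _,_ (A.identityʳ a) (B.identityʳ b) }) }
  ; size = A.size * B.size
  ; finite = ↔-trans (A.finite ×-↔ B.finite) (↔-sym *↔×) }
  where
    module A = FinMonoid A
    module B = FinMonoid B

Class : Set₂
Class = FinMonoid → Set₁

record IsVariety (V : Class) : Set₁ where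
  field
    -- closed under finite direct products (empty and binary products)
    trivial-closed : V trivial
    product-closed : ∀ A B → V A → V B → V (A ⊗ B)
    -- closed under submonoids (a submonoid of A = image of an injective hom into A)
    submonoid-closed : ∀ A B (f : Carrier B → Carrier A) →
                       IsHom B A f → Injective _≡_ _≡_ f → V A → V B
    quotient-closed : ∀ A B (f : Carrier A → Carrier B) →
                      IsHom A B f → Surjective _≡_ _≡_ f → V A → V B

module _ (M : FinMonoid) where
  open FinMonoid M

  _≤J_ : Carrier M → Carrier M → Set
  s₁ ≤J s₂ = ∃[ r ] ∃[ t ] (s₁ ≡ (r ∙ s₂) ∙ t)

  data InMₑ (e : Carrier M) : Carrier M → Set where
    gen-ε : InMₑ e ε
    gen-J : ∀ {m} → e ≤J m → InMₑ e m
    gen-∙ : ∀ {x y} → InMₑ e x → InMₑ e y → InMₑ e (x ∙ y)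

  InEMₑE : Carrier M → Carrier M → Set
  InEMₑE e x = ∃[ y ] (InMₑ e y × x ≡ (e ∙ y) ∙ e)

  -- N "is" the monoid e M_e e (with identity e): N embeds into M by an
  -- injective map preserving products, sending the identity of N to e,
  -- whose image is exactly e M_e e.
  record Presents (e : Carrier M) (N : FinMonoid) : Set where
    private module N = FinMonoid N
    field
      ι          : Carrier N → Carrier M
      ι-inj      : Injective _≡_ _≡_ ι
      ι-∙        : ∀ x y → ι (x N.∙ y) ≡ ι x ∙ ι y
      ι-ε        : ι N.ε ≡ e
      image-sub  : ∀ n → InEMₑE e (ι n)
      image-sup  : ∀ x → InEMₑE e x → ∃[ n ] (ι n ≡ x)

MₑV : Class → Class
MₑV V M = ∀ (e : Carrier M) → e ∙ e ≡ e →
          ∀ (N : FinMonoid) → Presents M e N → V N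
  where open FinMonoid M

module Submission where

-- Each closure property is witnessed by a map between local monoids e M_e e.
-- A homomorphism f sends e ≤J m to f e ≤J f m, hence maps e M_e e into
-- (f e) M_(f e) (f e); this embeds the local monoids of a submonoid into those
-- of the ambient monoid, and those of a product into products of local monoids.
-- For a surjection f : A → B and an idempotent e of B, lift e to an idempotent
-- e′ of A that is ≤J-minimal among the idempotent preimages of e. If e ≤J b and
-- b′ lifts b, some e′ x e′ with e′ x e′ ≤J b′ maps to e; an idempotent power of
-- it is again an idempotent preimage, J-below e′, so minimality gives e′ ≤J b′.
-- Hence f maps e′ A_e′ e′ onto e B_e e. Finiteness makes membership in M_e
-- decidable, which is what allows e M_e e to be built as a finite monoid.

open import Defs
open import Level using (0ℓ)
open import Algebra.Bundles using (Monoid)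
open import Data.Bool using (Bool; true; false; T)
open import Data.Bool.Properties using (T-≡; T-irrelevant)
open import Data.Fin using (Fin; zero; suc; toℕ)
import Data.Fin as Fin
open import Data.Fin.Properties using (any?; pigeonhole; +↔⊎; 1↔⊤)
open import Data.Fin.Subset using (Subset; _∈_; _⊂_; _⊃_; ∣_∣)
open import Data.Fin.Subset.Induction using (⊂-wellFounded; ⊃-wellFounded)
open import Data.Nat using (ℕ; zero; suc; _+_; _*_; _∸_; _≤_)
open import Data.Nat.Properties using (+-suc; m≤m*n; m∸n+n≡m; m≤n⇒∃[o]m+o≡n; n<1+n)
open import Data.Product using (Σ; ∃; ∃₂; _×_; _,_; proj₁; proj₂)
open import Data.Product.Function.Dependent.Propositional using (Σ-↔)
open import Data.Sum using (_⊎_; inj₁; inj₂)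
open import Data.Sum.Function.Propositional using (_⊎-↔_)
open import Data.Vec using (_∷_; tabulate)
open import Data.Vec.Properties using (lookup∘tabulate; []=⇒lookup; lookup⇒[]=)
open import Function using (_∘_)
open import Function.Bundles using (_↔_; Inverse; mk↔ₛ′; Equivalence)
open import Function.Consequences.Propositional
  using (surjective⇒strictlySurjective; strictlySurjective⇒surjective)
open import Function.Definitions using (Injective; Surjective)
open import Function.Properties.Inverse using (↔-refl; ↔-sym; ↔-trans)
open import Induction.WellFounded using (WellFounded; Acc; acc; module Subrelation)
import Relation.Binary.Construct.On as On
open import Relation.Binary.Definitions using (Reflexive; Transitive)
open import Relation.Binary.PropositionalEquality
open import Relation.Nullary using (Dec; yes; no; ¬_; ¬?)
open import Relation.Nullary.Decidable
  using (True; map′; isYes; decidable-stable; toWitness; fromWitness; _×-dec_; _⊎-dec_)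
open import Relation.Unary using (Pred; Decidable)
open import Tactic.MonoidSolver using (solve)

Σ-True-≡ : {A : Set} {P : Pred A 0ℓ} {P? : Decidable P} {x y : A}
           {p : True (P? x)} {q : True (P? y)} →
           x ≡ y → _≡_ {A = Σ A (True ∘ P?)} (x , p) (y , q)
Σ-True-≡ {p = p} {q} refl = cong (_ ,_) (T-irrelevant p q)

Σ-Fin-suc : ∀ {n} (P : Fin (suc n) → Set) → Σ (Fin (suc n)) P ↔ (P zero ⊎ Σ (Fin n) (P ∘ suc))
Σ-Fin-suc P = mk↔ₛ′ split join split∘join join∘split
  where
    split : Σ _ P → P zero ⊎ Σ _ (P ∘ suc)
    split (zero , p) = inj₁ p
    split (suc i , p) = inj₂ (i , p)
    join : P zero ⊎ Σ _ (P ∘ suc) → Σ _ P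
    join (inj₁ p) = zero , p
    join (inj₂ (i , p)) = suc i , p
    split∘join : ∀ s → split (join s) ≡ s
    split∘join (inj₁ _) = refl
    split∘join (inj₂ _) = refl
    join∘split : ∀ s → join (split s) ≡ s
    join∘split (zero , _) = refl
    join∘split (suc _ , _) = refl

Σ-T↔Fin : ∀ {n} (f : Fin n → Bool) → Σ (Fin n) (T ∘ f) ↔ Fin ∣ tabulate f ∣
Σ-T↔Fin {zero} f = mk↔ₛ′ (λ ()) (λ ()) (λ ()) (λ ())
Σ-T↔Fin {suc n} f = ↔-trans (Σ-Fin-suc (T ∘ f)) (count-head (f zero))
  where
    count-head : ∀ b → (T b ⊎ Σ (Fin n) (T ∘ f ∘ suc)) ↔ Fin ∣ b ∷ tabulate (f ∘ suc) ∣
    count-head true = ↔-trans (↔-sym 1↔⊤ ⊎-↔ Σ-T↔Fin (f ∘ suc)) (↔-sym (+↔⊎ {1}))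
    count-head false = ↔-trans drop-empty (Σ-T↔Fin (f ∘ suc))
      where
        drop-empty : ∀ {B : Set} → (T false ⊎ B) ↔ B
        drop-empty = mk↔ₛ′ (λ { (inj₁ ()) ; (inj₂ b) → b }) inj₂ (λ _ → refl)
                           (λ { (inj₁ ()) ; (inj₂ _) → refl })

module Finite {A : Set} {n : ℕ} (A↔Fin : A ↔ Fin n) where
  open Inverse A↔Fin using (to; from; strictlyInverseʳ)

  to-injective : ∀ {x y} → to x ≡ to y → x ≡ y
  to-injective {x} {y} eq = trans (sym (strictlyInverseʳ x)) (trans (cong from eq) (strictlyInverseʳ y))

  infix 4 _≟_
  _≟_ : (x y : A) → Dec (x ≡ y)
  x ≟ y = map′ to-injective (cong to) (to x Fin.≟ to y)

  ∃? : {P : Pred A 0ℓ} → Decidable P → Dec (∃ P)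
  ∃? {P} P? = map′ (λ (i , p) → from i , p)
                   (λ (x , p) → to x , subst P (sym (strictlyInverseʳ x)) p)
                   (any? (P? ∘ from))

  ⟦_⟧ : {P : Pred A 0ℓ} → Decidable P → Subset n
  ⟦ P? ⟧ = tabulate (λ i → isYes (P? (from i)))

  module _ {P : Pred A 0ℓ} (P? : Decidable P) where
    ∈⟦⟧⁻ : ∀ {i} → i ∈ ⟦ P? ⟧ → P (from i)
    ∈⟦⟧⁻ {i} i∈P =
      toWitness (Equivalence.from T-≡ (trans (sym (lookup∘tabulate _ i)) ([]=⇒lookup i∈P)))

    ∈⟦⟧⁺ : ∀ {i} → P (from i) → i ∈ ⟦ P? ⟧
    ∈⟦⟧⁺ {i} p =
      lookup⇒[]= i _ (trans (lookup∘tabulate _ i) (Equivalence.to T-≡ (fromWitness p)))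

  ⟦⟧-⊂ : {P Q : Pred A 0ℓ} (P? : Decidable P) (Q? : Decidable Q) →
         (∀ {x} → P x → Q x) → ∀ {x} → Q x → ¬ P x → ⟦ P? ⟧ ⊂ ⟦ Q? ⟧
  ⟦⟧-⊂ {P} {Q} P? Q? P⊆Q {x} qx ¬px =
    (λ i∈P → ∈⟦⟧⁺ Q? (P⊆Q (∈⟦⟧⁻ P? i∈P))) ,
    to x , ∈⟦⟧⁺ Q? (subst Q (sym (strictlyInverseʳ x)) qx) ,
    λ x∈P → ¬px (subst P (strictlyInverseʳ x) (∈⟦⟧⁻ P? x∈P))

  Σ-True↔Fin : {P : Pred A 0ℓ} (P? : Decidable P) → Σ A (True ∘ P?) ↔ Fin ∣ ⟦ P? ⟧ ∣
  Σ-True↔Fin P? = ↔-trans (↔-sym (Σ-↔ (↔-sym A↔Fin) ↔-refl)) (Σ-T↔Fin _)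

  chain-stabilises : (P : ℕ → Pred A 0ℓ) → (∀ k → Decidable (P k)) →
                     (∀ k {x} → P k x → P (suc k) x) →
                     ∃ λ m → ∀ {x} → P (suc m) x → P m x
  chain-stabilises P P? mono = go 0 (⊃-wellFounded _)
    where
      go : ∀ k → Acc _⊃_ ⟦ P? k ⟧ → ∃ λ m → ∀ {x} → P (suc m) x → P m x
      go k (acc rs) with ∃? (λ x → P? (suc k) x ×-dec ¬? (P? k x))
      ... | yes (x , grows , ¬old) = go (suc k) (rs (⟦⟧-⊂ (P? k) (P? (suc k)) (mono k) grows ¬old))
      ... | no stable = k , λ {x} new → decidable-stable (P? k x) (λ ¬old → stable (x , new , ¬old))

  module _ {R : A → A → Set} (R? : ∀ x y → Dec (R x y))
           (refl-R : Reflexive R) (trans-R : Transitive R) where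
    Strict : A → A → Set
    Strict x y = R x y × ¬ R y x

    strict-wellFounded : WellFounded Strict
    strict-wellFounded = Subrelation.wellFounded below-⊂ (On.wellFounded below ⊂-wellFounded)
      where
        below : A → Subset n
        below x = ⟦ (λ z → R? z x) ⟧
        below-⊂ : ∀ {x y} → Strict x y → below x ⊂ below y
        below-⊂ {x} {y} (rxy , ¬ryx) =
          ⟦⟧-⊂ (λ z → R? z x) (λ z → R? z y) (λ rzx → trans-R rzx rxy) refl-R ¬ryx

    ∃-minimal : {P : Pred A 0ℓ} → Decidable P → ∀ {x} → P x →
                ∃ λ m → P m × (∀ {y} → P y → R y m → R m y)
    ∃-minimal {P} P? px = descend _ px (strict-wellFounded _)
      where
        descend : ∀ x → P x → Acc Strict x → ∃ λ m → P m × (∀ {y} → P y → R y m → R m y)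
        descend x px (acc below) with ∃? (λ y → P? y ×-dec (R? y x ×-dec ¬? (R? x y)))
        ... | yes (y , py , ryx , ¬rxy) = descend y py (below (ryx , ¬rxy))
        ... | no none = x , px , λ {y} py ryx →
                decidable-stable (R? x y) (λ ¬rxy → none (y , py , ryx , ¬rxy))

module FinMonoidProperties (M : FinMonoid) where
  open FinMonoid M using (_∙_; ε; isMonoid; size; finite; assoc; identityˡ; identityʳ)
  open Finite finite
  open Inverse finite using (to)
  open ≡-Reasoning

  monoid : Monoid 0ℓ 0ℓ
  monoid = record { isMonoid = isMonoid }

  open import Algebra.Definitions.RawMonoid (Monoid.rawMonoid monoid) renaming (_×_ to _times_) using ()
  open import Algebra.Properties.Monoid.Mult monoid using (×-homo-+; ×-assocˡ)

  infixr 8 _^_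
  _^_ : Carrier M → ℕ → Carrier M
  x ^ k = k times x

  ≤J-refl : Reflexive (_≤J_ M)
  ≤J-refl {x} = ε , ε , solve monoid

  ≤J-trans : Transitive (_≤J_ M)
  ≤J-trans {k = z} (r , t , refl) (r′ , t′ , refl) = r ∙ r′ , t′ ∙ t , solve monoid

  ≤J? : ∀ x y → Dec (_≤J_ M x y)
  ≤J? x y = ∃? (λ r → ∃? (λ t → x ≟ (r ∙ y) ∙ t))

  ^≤J : ∀ x k → _≤J_ M (x ^ suc k) x
  ^≤J x k = ε , x ^ k , cong (_∙ x ^ k) (sym (identityˡ x))

  ∙-^-absorb : ∀ {y z} → y ∙ z ≡ y → ∀ c → y ∙ z ^ c ≡ y
  ∙-^-absorb {y} {z} yz≡y zero = identityʳ y
  ∙-^-absorb {y} {z} yz≡y (suc c) = begin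
    y ∙ (z ∙ z ^ c)  ≡⟨ assoc y z (z ^ c) ⟨
    (y ∙ z) ∙ z ^ c  ≡⟨ cong (_∙ z ^ c) yz≡y ⟩
    y ∙ z ^ c        ≡⟨ ∙-^-absorb yz≡y c ⟩
    y                ∎

  ^-absorb-≤ : ∀ {x z a m} → x ^ a ∙ z ≡ x ^ a → a ≤ m → x ^ m ∙ z ≡ x ^ m
  ^-absorb-≤ {x} {z} {a} {m} absorb a≤m = begin
    x ^ m ∙ z                  ≡⟨ cong (λ k → x ^ k ∙ z) (m∸n+n≡m a≤m) ⟨
    x ^ (d + a) ∙ z            ≡⟨ cong (_∙ z) (×-homo-+ x d a) ⟩
    (x ^ d ∙ x ^ a) ∙ z        ≡⟨ assoc (x ^ d) (x ^ a) z ⟩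
    x ^ d ∙ (x ^ a ∙ z)        ≡⟨ cong (x ^ d ∙_) absorb ⟩
    x ^ d ∙ x ^ a              ≡⟨ ×-homo-+ x d a ⟨
    x ^ (d + a)                ≡⟨ cong (x ^_) (m∸n+n≡m a≤m) ⟩
    x ^ m                      ∎
    where d = m ∸ a

  idempotent-^ : ∀ {x} → x ∙ x ≡ x → ∀ k → x ^ suc k ≡ x
  idempotent-^ {x} idem zero = identityʳ x
  idempotent-^ {x} idem (suc k) = trans (cong (x ∙_) (idempotent-^ idem k)) idem

  ^-eventually-periodic : ∀ x → ∃₂ λ a p → x ^ suc a ∙ x ^ suc p ≡ x ^ suc a
  ^-eventually-periodic x with pigeonhole (n<1+n size) (λ i → to (x ^ suc (toℕ i)))
  ... | i , j , i<j , same with m≤n⇒∃[o]m+o≡n i<j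
  ... | p , i+1+p≡j = toℕ i , p , (begin
    x ^ suc (toℕ i) ∙ x ^ suc p  ≡⟨ ×-homo-+ x (suc (toℕ i)) (suc p) ⟨
    x ^ (suc (toℕ i) + suc p)    ≡⟨ cong (λ k → x ^ suc k) (trans (+-suc (toℕ i) p) i+1+p≡j) ⟩
    x ^ suc (toℕ j)              ≡⟨ to-injective same ⟨
    x ^ suc (toℕ i)              ∎)

  -- x ^ N is idempotent as soon as N is a multiple of the period and at least the preperiod.
  ^-idempotent : ∀ x → ∃ λ k → x ^ suc k ∙ x ^ suc k ≡ x ^ suc k
  ^-idempotent x with ^-eventually-periodic x
  ... | a , p , absorb = p + a * suc p , (begin
    x ^ N ∙ x ^ N                ≡⟨ cong (x ^ N ∙_) (×-assocˡ x (suc a) (suc p)) ⟨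
    x ^ N ∙ (x ^ suc p) ^ suc a  ≡⟨ ∙-^-absorb (^-absorb-≤ absorb (m≤m*n (suc a) (suc p))) (suc a) ⟩
    x ^ N                        ∎)
    where N = suc a * suc p

  module _ (e : Carrier M) where
    InMₑ≤ : ℕ → Carrier M → Set
    InMₑ≤ zero y = y ≡ ε
    InMₑ≤ (suc k) y = InMₑ≤ k y ⊎ ∃₂ λ g z → _≤J_ M e g × InMₑ≤ k z × y ≡ g ∙ z

    InMₑ≤? : ∀ k → Decidable (InMₑ≤ k)
    InMₑ≤? zero y = y ≟ ε
    InMₑ≤? (suc k) y =
      InMₑ≤? k y ⊎-dec ∃? (λ g → ∃? (λ z → ≤J? e g ×-dec InMₑ≤? k z ×-dec y ≟ g ∙ z))

    ε∈InMₑ≤ : ∀ k → InMₑ≤ k ε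
    ε∈InMₑ≤ zero = refl
    ε∈InMₑ≤ (suc k) = inj₁ (ε∈InMₑ≤ k)

    InMₑ≤-∙ : ∀ j {k x y} → InMₑ≤ j x → InMₑ≤ k y → InMₑ≤ (j + k) (x ∙ y)
    InMₑ≤-∙ zero refl y∈ = subst (InMₑ≤ _) (sym (identityˡ _)) y∈
    InMₑ≤-∙ (suc j) (inj₁ x∈) y∈ = inj₁ (InMₑ≤-∙ j x∈ y∈)
    InMₑ≤-∙ (suc j) {y = y} (inj₂ (g , z , e≤g , z∈ , refl)) y∈ =
      inj₂ (g , z ∙ y , e≤g , InMₑ≤-∙ j z∈ y∈ , assoc g z y)

    InMₑ≤⇒InMₑ : ∀ {k y} → InMₑ≤ k y → InMₑ M e y
    InMₑ≤⇒InMₑ {zero} refl = gen-ε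
    InMₑ≤⇒InMₑ {suc k} (inj₁ y∈) = InMₑ≤⇒InMₑ y∈
    InMₑ≤⇒InMₑ {suc k} (inj₂ (g , z , e≤g , z∈ , refl)) = gen-∙ (gen-J e≤g) (InMₑ≤⇒InMₑ z∈)

    InMₑ⇒InMₑ≤ : ∀ {y} → InMₑ M e y → ∃ λ k → InMₑ≤ k y
    InMₑ⇒InMₑ≤ gen-ε = 0 , refl
    InMₑ⇒InMₑ≤ (gen-J {m} e≤m) = 1 , inj₂ (m , ε , e≤m , refl , sym (identityʳ m))
    InMₑ⇒InMₑ≤ (gen-∙ x∈ y∈) with InMₑ⇒InMₑ≤ x∈ | InMₑ⇒InMₑ≤ y∈
    ... | j , x∈ⱼ | k , y∈ₖ = j + k , InMₑ≤-∙ j x∈ⱼ y∈ₖ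

    InMₑ≤-stable : ∀ {m} → (∀ {y} → InMₑ≤ (suc m) y → InMₑ≤ m y) →
                   ∀ k {y} → InMₑ≤ k y → InMₑ≤ m y
    InMₑ≤-stable {m} stable zero refl = ε∈InMₑ≤ m
    InMₑ≤-stable stable (suc k) (inj₁ y∈) = InMₑ≤-stable stable k y∈
    InMₑ≤-stable stable (suc k) (inj₂ (g , z , e≤g , z∈ , y≡gz)) =
      stable (inj₂ (g , z , e≤g , InMₑ≤-stable stable k z∈ , y≡gz))

    InMₑ? : Decidable (InMₑ M e)
    InMₑ? y with chain-stabilises InMₑ≤ InMₑ≤? (λ _ → inj₁)
    ... | m , stable =
      map′ InMₑ≤⇒InMₑ (λ y∈ → InMₑ≤-stable stable _ (proj₂ (InMₑ⇒InMₑ≤ y∈))) (InMₑ≤? m y)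

  module _ {e : Carrier M} (idem : e ∙ e ≡ e) where
    InEMₑE? : Decidable (InEMₑE M e)
    InEMₑE? x = ∃? (λ y → InMₑ? e y ×-dec x ≟ (e ∙ y) ∙ e)

    e∈EMₑE : InEMₑE M e e
    e∈EMₑE = ε , gen-ε , (begin
      e            ≡⟨ idem ⟨
      e ∙ e        ≡⟨ cong (_∙ e) (identityʳ e) ⟨
      (e ∙ ε) ∙ e  ∎)

    InEMₑE-∙ : ∀ {x y} → InEMₑE M e x → InEMₑE M e y → InEMₑE M e (x ∙ y)
    InEMₑE-∙ (a , a∈ , refl) (b , b∈ , refl) =
      a ∙ (e ∙ b) , gen-∙ a∈ (gen-∙ (gen-J ≤J-refl) b∈) , (begin
        ((e ∙ a) ∙ e) ∙ ((e ∙ b) ∙ e)    ≡⟨ solve monoid ⟩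
        (e ∙ (a ∙ ((e ∙ e) ∙ b))) ∙ e    ≡⟨ cong (λ u → (e ∙ (a ∙ (u ∙ b))) ∙ e) idem ⟩
        (e ∙ (a ∙ (e ∙ b))) ∙ e          ∎)

    e-identityˡ : ∀ {x} → InEMₑE M e x → e ∙ x ≡ x
    e-identityˡ (a , _ , refl) = begin
      e ∙ ((e ∙ a) ∙ e)  ≡⟨ solve monoid ⟩
      ((e ∙ e) ∙ a) ∙ e  ≡⟨ cong (λ u → (u ∙ a) ∙ e) idem ⟩
      (e ∙ a) ∙ e        ∎

    e-identityʳ : ∀ {x} → InEMₑE M e x → x ∙ e ≡ x
    e-identityʳ (a , _ , refl) = begin
      ((e ∙ a) ∙ e) ∙ e  ≡⟨ solve monoid ⟩
      (e ∙ a) ∙ (e ∙ e)  ≡⟨ cong ((e ∙ a) ∙_) idem ⟩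
      (e ∙ a) ∙ e        ∎

    -- A subtype through the decision procedure, so that membership proofs are unique
    -- and the inclusion ι = proj₁ is injective.
    EMₑE : Set
    EMₑE = Σ (Carrier M) (True ∘ InEMₑE?)

    _·_ : EMₑE → EMₑE → EMₑE
    (x , x∈) · (y , y∈) = x ∙ y , fromWitness (InEMₑE-∙ (toWitness x∈) (toWitness y∈))

    eMₑe : FinMonoid
    eMₑe = record
      { Carrier  = EMₑE
      ; _∙_      = _·_
      ; ε        = e , fromWitness e∈EMₑE
      ; isMonoid = record
        { isSemigroup = record
          { isMagma = record { isEquivalence = isEquivalence ; ∙-cong = cong₂ _·_ }
          ; assoc   = λ x y z → Σ-True-≡ (assoc (proj₁ x) (proj₁ y) (proj₁ z)) }
        ; identity = (λ (x , x∈) → Σ-True-≡ (e-identityˡ (toWitness x∈)))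
                   , (λ (x , x∈) → Σ-True-≡ (e-identityʳ (toWitness x∈))) }
      ; size     = ∣ ⟦ InEMₑE? ⟧ ∣
      ; finite   = Σ-True↔Fin InEMₑE? }

    eMₑe-presents : Presents M e eMₑe
    eMₑe-presents = record
      { ι         = proj₁
      ; ι-inj     = Σ-True-≡
      ; ι-∙       = λ _ _ → refl
      ; ι-ε       = refl
      ; image-sub = λ (x , x∈) → toWitness x∈
      ; image-sup = λ x x∈ → (x , fromWitness x∈) , refl }

module HomProperties {A B : FinMonoid} {f : Carrier A → Carrier B} (f-hom : IsHom A B f) where
  private
    module A = FinMonoid A
    module B = FinMonoid B
  open IsHom f-hom
  open FinMonoidProperties using (_^_)

  preserves-∙∙ : ∀ x y z → f ((x A.∙ y) A.∙ z) ≡ (f x B.∙ f y) B.∙ f z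
  preserves-∙∙ x y z = trans (preserves-∙ (x A.∙ y) z) (cong (B._∙ f z) (preserves-∙ x y))

  preserves-^ : ∀ x k → f (_^_ A x k) ≡ _^_ B (f x) k
  preserves-^ x zero = preserves-ε
  preserves-^ x (suc k) = trans (preserves-∙ x _) (cong (f x B.∙_) (preserves-^ x k))

  ≤J-map : ∀ {x y} → _≤J_ A x y → _≤J_ B (f x) (f y)
  ≤J-map {y = y} (r , t , refl) = f r , f t , preserves-∙∙ r y t

  InMₑ-map : ∀ {e x} → InMₑ A e x → InMₑ B (f e) (f x)
  InMₑ-map gen-ε = subst (InMₑ B _) (sym preserves-ε) gen-ε
  InMₑ-map (gen-J e≤x) = gen-J (≤J-map e≤x)
  InMₑ-map (gen-∙ x∈ y∈) =
    subst (InMₑ B _) (sym (preserves-∙ _ _)) (gen-∙ (InMₑ-map x∈) (InMₑ-map y∈))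

  InEMₑE-map : ∀ {e x} → InEMₑE A e x → InEMₑE B (f e) (f x)
  InEMₑE-map {e} (y , y∈ , refl) = f y , InMₑ-map y∈ , preserves-∙∙ e y e

module Corestriction {M N′ : FinMonoid} {e : Carrier M} (N′-presents : Presents M e N′)
                     (N : FinMonoid) (g : Carrier N → Carrier M)
                     (g-∙ : ∀ x y → g (FinMonoid._∙_ N x y) ≡ FinMonoid._∙_ M (g x) (g y))
                     (g-ε : g (FinMonoid.ε N) ≡ e)
                     (g∈EMₑE : ∀ x → InEMₑE M e (g x)) where
  open Presents N′-presents
  private
    module M = FinMonoid M

  h : Carrier N → Carrier N′
  h x = proj₁ (image-sup (g x) (g∈EMₑE x))

  ι∘h : ∀ x → ι (h x) ≡ g x
  ι∘h x = proj₂ (image-sup (g x) (g∈EMₑE x))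

  h-hom : IsHom N N′ h
  h-hom = record
    { preserves-∙ = λ x y → ι-inj (begin
        ι (h (x N.∙ y))           ≡⟨ ι∘h (x N.∙ y) ⟩
        g (x N.∙ y)               ≡⟨ g-∙ x y ⟩
        g x M.∙ g y               ≡⟨ cong₂ M._∙_ (ι∘h x) (ι∘h y) ⟨
        ι (h x) M.∙ ι (h y)       ≡⟨ ι-∙ (h x) (h y) ⟨
        ι (h x N′.∙ h y)          ∎)
    ; preserves-ε = ι-inj (trans (ι∘h N.ε) (trans g-ε (sym ι-ε))) }
    where
      open ≡-Reasoning
      module N = FinMonoid N
      module N′ = FinMonoid N′

  h≡⇒g≡ : ∀ {x y} → h x ≡ h y → g x ≡ g y
  h≡⇒g≡ {x} {y} hx≡hy = trans (sym (ι∘h x)) (trans (cong ι hx≡hy) (ι∘h y))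

module IdempotentLift {A B : FinMonoid} {f : Carrier A → Carrier B} (f-hom : IsHom A B f)
                      (f-surj : Surjective _≡_ _≡_ f)
                      {e : Carrier B} (idem : FinMonoid._∙_ B e e ≡ e) where
  private
    module A = FinMonoid A
    module B = FinMonoid B
    module TA = FinMonoidProperties A
    module TB = FinMonoidProperties B
    module FA = Finite A.finite
    module FB = Finite B.finite
  open IsHom f-hom
  open HomProperties f-hom
  open ≡-Reasoning

  lift : ∀ b → ∃ λ a → f a ≡ b
  lift = surjective⇒strictlySurjective f-surj

  IdempotentPreimage : Carrier A → Set
  IdempotentPreimage d = d A.∙ d ≡ d × f d ≡ e

  idempotent-preimage-below : ∀ {x} → f x ≡ e → ∃ λ d → IdempotentPreimage d × _≤J_ A d x
  idempotent-preimage-below {x} fx≡e with TA.^-idempotent x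
  ... | k , d-idem = TA._^_ x (suc k) , (d-idem , fd≡e) , TA.^≤J x k
    where
      fd≡e : f (TA._^_ x (suc k)) ≡ e
      fd≡e = begin
        f (TA._^_ x (suc k))    ≡⟨ preserves-^ x (suc k) ⟩
        TB._^_ (f x) (suc k)    ≡⟨ cong (λ u → TB._^_ u (suc k)) fx≡e ⟩
        TB._^_ e (suc k)        ≡⟨ TB.idempotent-^ idem k ⟩
        e                       ∎

  minimal-preimage : ∃ λ e′ → IdempotentPreimage e′ ×
                     (∀ {d} → IdempotentPreimage d → _≤J_ A d e′ → _≤J_ A e′ d)
  minimal-preimage =
    FA.∃-minimal TA.≤J? TA.≤J-refl TA.≤J-trans
      (λ d → (d A.∙ d FA.≟ d) ×-dec (f d FB.≟ e))
      (proj₁ (proj₂ (idempotent-preimage-below (proj₂ (lift e)))))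

  -- e′ is computed by well-founded recursion over A: goals mentioning it must not
  -- be normalised (by `with`-abstraction or the monoid solver), hence the `let`s.
  e′ : Carrier A
  e′ = proj₁ minimal-preimage

  e′-idem : e′ A.∙ e′ ≡ e′
  e′-idem = proj₁ (proj₁ (proj₂ minimal-preimage))

  fe′≡e : f e′ ≡ e
  fe′≡e = proj₂ (proj₁ (proj₂ minimal-preimage))

  e′-minimal : ∀ {d} → IdempotentPreimage d → _≤J_ A d e′ → _≤J_ A e′ d
  e′-minimal = proj₂ (proj₂ minimal-preimage)

  lift-≤J : ∀ {b} → _≤J_ B e b → ∃ λ a → _≤J_ A e′ a × f a ≡ b
  lift-≤J {b} (r , t , e≡rbt) = b′ , e′≤b′ , fb′≡b
    where
      r′ = proj₁ (lift r)
      b′ = proj₁ (lift b)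
      t′ = proj₁ (lift t)
      fb′≡b = proj₂ (lift b)
      q = (r′ A.∙ b′) A.∙ t′
      x = (e′ A.∙ q) A.∙ e′

      fq≡rbt : f q ≡ (r B.∙ b) B.∙ t
      fq≡rbt = trans (preserves-∙∙ r′ b′ t′)
                     (cong₂ B._∙_ (cong₂ B._∙_ (proj₂ (lift r)) fb′≡b) (proj₂ (lift t)))

      fx≡e : f x ≡ e
      fx≡e = begin
        f x                              ≡⟨ preserves-∙∙ e′ q e′ ⟩
        (f e′ B.∙ f q) B.∙ f e′          ≡⟨ cong₂ (λ u v → (u B.∙ v) B.∙ u) fe′≡e fq≡rbt ⟩
        (e B.∙ ((r B.∙ b) B.∙ t)) B.∙ e  ≡⟨ cong (λ u → (e B.∙ u) B.∙ e) e≡rbt ⟨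
        (e B.∙ e) B.∙ e                  ≡⟨ cong (B._∙ e) idem ⟩
        e B.∙ e                          ≡⟨ idem ⟩
        e                                ∎

      below-x = idempotent-preimage-below fx≡e
      d≤x = proj₂ (proj₂ below-x)

      x≤e′ : _≤J_ A x e′
      x≤e′ = e′ A.∙ q , A.ε , sym (A.identityʳ x)

      x≤b′ : _≤J_ A x b′
      x≤b′ = TA.≤J-trans (e′ , e′ , refl) (r′ , t′ , refl)

      e′≤b′ : _≤J_ A e′ b′
      e′≤b′ = TA.≤J-trans (e′-minimal (proj₁ (proj₂ below-x)) (TA.≤J-trans d≤x x≤e′))
                          (TA.≤J-trans d≤x x≤b′)

  lift-InMₑ : ∀ {b} → InMₑ B e b → ∃ λ a → InMₑ A e′ a × f a ≡ b
  lift-InMₑ gen-ε = A.ε , gen-ε , preserves-ε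
  lift-InMₑ (gen-J e≤b) =
    let a , e′≤a , fa≡b = lift-≤J e≤b in a , gen-J e′≤a , fa≡b
  lift-InMₑ (gen-∙ x∈ y∈) =
    let a , a∈ , fa≡x = lift-InMₑ x∈
        c , c∈ , fc≡y = lift-InMₑ y∈
    in a A.∙ c , gen-∙ a∈ c∈ , trans (preserves-∙ a c) (cong₂ B._∙_ fa≡x fc≡y)

proj₁-isHom : ∀ {A B} → IsHom (A ⊗ B) A proj₁
proj₁-isHom = record { preserves-∙ = λ _ _ → refl ; preserves-ε = refl }

proj₂-isHom : ∀ {A B} → IsHom (A ⊗ B) B proj₂
proj₂-isHom = record { preserves-∙ = λ _ _ → refl ; preserves-ε = refl }

<,>-isHom : ∀ {N A B f g} → IsHom N A f → IsHom N B g → IsHom N (A ⊗ B) (λ x → f x , g x)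
<,>-isHom f-hom g-hom = record
  { preserves-∙ = λ x y → cong₂ _,_ (IsHom.preserves-∙ f-hom x y) (IsHom.preserves-∙ g-hom x y)
  ; preserves-ε = cong₂ _,_ (IsHom.preserves-ε f-hom) (IsHom.preserves-ε g-hom) }

module MₑV-closure (V : Class) (V-variety : IsVariety V) where
  open IsVariety V-variety
  open HomProperties using (InEMₑE-map)

  MₑV-trivial : MₑV V trivial
  MₑV-trivial _ _ N N-presents =
    submonoid-closed trivial N ι (record { preserves-∙ = λ _ _ → refl ; preserves-ε = refl })
      ι-inj trivial-closed
    where open Presents N-presents

  MₑV-⊗ : ∀ A B → MₑV V A → MₑV V B → MₑV V (A ⊗ B)
  MₑV-⊗ A B A∈ B∈ (e₁ , e₂) idem N N-presents =
    submonoid-closed (TA.eMₑe idem₁ ⊗ TB.eMₑe idem₂) N (λ x → F₁.h x , F₂.h x)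
      (<,>-isHom F₁.h-hom F₂.h-hom)
      (λ hx≡hy → ι-inj (cong₂ _,_ (F₁.h≡⇒g≡ (cong proj₁ hx≡hy)) (F₂.h≡⇒g≡ (cong proj₂ hx≡hy))))
      (product-closed _ _ (A∈ e₁ idem₁ _ (TA.eMₑe-presents idem₁))
                          (B∈ e₂ idem₂ _ (TB.eMₑe-presents idem₂)))
    where
      module TA = FinMonoidProperties A
      module TB = FinMonoidProperties B
      open Presents N-presents
      idem₁ = cong proj₁ idem
      idem₂ = cong proj₂ idem
      module F₁ = Corestriction (TA.eMₑe-presents idem₁) N (proj₁ ∘ ι)
                    (λ x y → cong proj₁ (ι-∙ x y)) (cong proj₁ ι-ε)
                    (λ x → InEMₑE-map proj₁-isHom (image-sub x))
      module F₂ = Corestriction (TB.eMₑe-presents idem₂) N (proj₂ ∘ ι)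
                    (λ x y → cong proj₂ (ι-∙ x y)) (cong proj₂ ι-ε)
                    (λ x → InEMₑE-map proj₂-isHom (image-sub x))

  MₑV-submonoid : ∀ A B (f : Carrier B → Carrier A) → IsHom B A f → Injective _≡_ _≡_ f →
                  MₑV V A → MₑV V B
  MₑV-submonoid A B f f-hom f-inj A∈ e idem N N-presents =
    submonoid-closed (TA.eMₑe fe-idem) N F.h F.h-hom (λ hx≡hy → ι-inj (f-inj (F.h≡⇒g≡ hx≡hy)))
      (A∈ (f e) fe-idem _ (TA.eMₑe-presents fe-idem))
    where
      module TA = FinMonoidProperties A
      open Presents N-presents
      open IsHom f-hom
      fe-idem = trans (sym (preserves-∙ e e)) (cong f idem)
      module F = Corestriction (TA.eMₑe-presents fe-idem) N (f ∘ ι)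
                   (λ x y → trans (cong f (ι-∙ x y)) (preserves-∙ (ι x) (ι y))) (cong f ι-ε)
                   (λ x → InEMₑE-map f-hom (image-sub x))

  MₑV-quotient : ∀ A B (f : Carrier A → Carrier B) → IsHom A B f → Surjective _≡_ _≡_ f →
                 MₑV V A → MₑV V B
  MₑV-quotient A B f f-hom f-surj A∈ e idem N N-presents =
    quotient-closed (TA.eMₑe e′-idem) N F.h F.h-hom (strictlySurjective⇒surjective h-onto)
      (A∈ e′ e′-idem _ (TA.eMₑe-presents e′-idem))
    where
      module TA = FinMonoidProperties A
      module A = FinMonoid A
      module B = FinMonoid B
      open IdempotentLift f-hom f-surj idem
      open Presents N-presents
      open IsHom f-hom
      open HomProperties f-hom using (preserves-∙∙)
      open ≡-Reasoning
      module F = Corestriction N-presents (TA.eMₑe e′-idem) (f ∘ proj₁)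
                   (λ x y → preserves-∙ (proj₁ x) (proj₁ y)) fe′≡e
                   (λ (x , x∈) → subst (λ u → InEMₑE B u (f x)) fe′≡e
                                       (InEMₑE-map f-hom (toWitness x∈)))

      h-onto : ∀ n → ∃ λ x → F.h x ≡ n
      h-onto n =
        let y , y∈ , ιn≡eye = image-sub n
            a , a∈ , fa≡y = lift-InMₑ y∈
            x = (e′ A.∙ a) A.∙ e′ , fromWitness (a , a∈ , refl)
        in x , ι-inj (begin
          ι (F.h x)                       ≡⟨ F.ι∘h x ⟩
          f ((e′ A.∙ a) A.∙ e′)           ≡⟨ preserves-∙∙ e′ a e′ ⟩
          (f e′ B.∙ f a) B.∙ f e′         ≡⟨ cong₂ (λ u v → (u B.∙ v) B.∙ u) fe′≡e fa≡y ⟩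
          (e B.∙ y) B.∙ e                 ≡⟨ ιn≡eye ⟨
          ι n                             ∎)

proposition5p1 : (V : Class) → IsVariety V → IsVariety (MₑV V)
proposition5p1 V V-variety = record
  { trivial-closed   = MₑV-trivial
  ; product-closed   = MₑV-⊗
  ; submonoid-closed = MₑV-submonoid
  ; quotient-closed  = MₑV-quotient }
  where open MₑV-closure V V-variety
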